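{- Let $n\ge 3$ and $l\ge 2$. For any $2l$-cycle $C$ in $CT_n$, we have $|\mathrm{supp}(C)|\le 2l$.
   Context: $CT_n$ is the graph with vertex set the symmetric group $\mathrm{S}_n$ on $\{1,\dots,n\}$ in which $x,y$ are adjacent iff $y=ux$ for some transposition $u$. For $x\in\mathrm{S}_n$, $\mathrm{supp}(x)=\{i:i^x\ne i\}$; for an edge $\{u,z\}$, $\mathrm{supp}(\{u,z\})=\mathrm{supp}(zu^{ -1})$; for a subgraph $H$ of $CT_n$, $\mathrm{supp}(H)=\bigcup_{\{u,z\}\in E(H)}\mathrm{supp}(\{u,z\})$. -}

module Defs where

open import Data.Nat using (ℕ; zero; suc; _<?_)
open import Data.Fin using (Fin; zero; suc; toℕ; fromℕ<; _≟_)
open import Data.Fin.Permutation using (Permutation′; _⟨$⟩ʳ_; _⟨$⟩ˡ_; transpose)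
open import Data.Fin.Subset using (Subset)
open import Data.Fin.Properties using (any?)
open import Data.Vec using (tabulate)
open import Data.Product using (∃; ∃₂; _×_)
open import Relation.Nullary using (¬_; does; yes; no; ¬?)
open import Relation.Binary.PropositionalEquality using (_≡_; _≢_)

-- Vertices of CT_n: permutations of Fin n (i.e. of {1,…,n}).
-- Elements act on the right: i^x.  Products are read left to right,
-- i^(xy) = (i^x)^y, i.e. as functions xy = y ∘ x.

_≈ₚ_ : ∀ {n} → Permutation′ n → Permutation′ n → Set
x ≈ₚ y = ∀ k → x ⟨$⟩ʳ k ≡ y ⟨$⟩ʳ k

-- Adjacency in CT_n: y = u x for some transposition u = (i j), i ≠ j.
-- With right actions, k^(ux) = (k^u)^x.
Adjacent : ∀ {n} → Permutation′ n → Permutation′ n → Set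
Adjacent {n} x y =
  ∃₂ λ (i j : Fin n) → i ≢ j × (∀ k → y ⟨$⟩ʳ k ≡ x ⟨$⟩ʳ (transpose i j ⟨$⟩ʳ k))

next : ∀ {m} → Fin m → Fin m
next {suc m} i with suc (toℕ i) <? suc m
... | yes p = fromℕ< p
... | no _  = zero

record Cycle (n L : ℕ) : Set where
  field
    vertex   : Fin L → Permutation′ n
    distinct : ∀ a b → vertex a ≈ₚ vertex b → a ≡ b
    adjacent : ∀ a → Adjacent (vertex a) (vertex (next a))
open Cycle public

-- k ∈ supp({u,z}) = supp(z u⁻¹) iff k^(z u⁻¹) = (k^z)^(u⁻¹) ≠ k.
-- supp(C): union of the supports of the edges {c a, c (a+1)} of C,
-- as a (decidable) subset of Fin n.
supp : ∀ {n L} → Cycle n L → Subset n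
supp C = tabulate λ k →
  does (any? λ a → ¬? (vertex C a ⟨$⟩ˡ (vertex C (next a) ⟨$⟩ʳ k) ≟ k))

{-# OPTIONS --safe #-}
module Submission where

-- Double count the pairs (k, a) such that the edge from c a to c (a+1) moves the point k.
-- An edge y = u x moves only the two points of the transposition u, so there are at most
-- 2L such pairs.  On the other hand, if one edge moves k then so does another: the points
-- k^(c a) return to their start after going round the cycle, so they cannot change at
-- exactly one step.  Hence 2 ∣supp C∣ ≤ 2L.

open import Defs
open import Data.Nat using (ℕ; _≤_; _*_; zero; suc; _+_; _<_; _<?_; z≤n; s≤s)
open import Data.Fin.Subset using (∣_∣)

import Algebra.Properties.CommutativeMonoid.Sum as Sum
open import Data.Bool using (Bool; true; false)
open import Data.Fin as Fin using (Fin; zero; suc; toℕ; inject₁; fromℕ; _≟_)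
open import Data.Fin.Induction using (<-weakInduction)
open import Data.Fin.Permutation using (Permutation′; _⟨$⟩ʳ_; _⟨$⟩ˡ_; transpose; inverseˡ; inverseʳ)
open import Data.Fin.Properties
  using (any?; toℕ-injective; toℕ-fromℕ<; toℕ-fromℕ; toℕ-inject₁; toℕ<n; ≤fromℕ; ≤∧≢⇒<; ℕ<⇒inject₁<; <⇒≢;
         punchIn-punchOut)
open import Data.Nat.Properties
  using (+-0-commutativeMonoid; ≤-refl; ≤-trans; <⇒≤; +-mono-≤; +-mono-<; m≤m+n; n≮n; ≮⇒≥; <⇒≱;
         m≤n⇒m<n∨m≡n; *-suc; *-identityʳ; ≤-reflexive; module ≤-Reasoning)
open import Data.Product using (∃; _,_)
open import Data.Sum using (inj₁; inj₂)
open import Data.Vec using (tabulate)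
open import Function using (_∘_)
open import Relation.Nullary using (¬_; Dec; yes; no; does; ¬?; _×-dec_; contradiction)
open import Relation.Nullary.Decidable using (dec-true; dec-false; decidable-stable)
open import Relation.Binary.PropositionalEquality
  using (_≡_; _≢_; refl; sym; trans; cong; cong₂; subst; module ≡-Reasoning)

open Sum +-0-commutativeMonoid using (sum; sum-syntax; sum-remove; ∑-comm; ∑-distrib-+; sum-replicate-zero)

indicator : Bool → ℕ
indicator true  = 1
indicator false = 0

∣tabulate∣≡∑indicator : ∀ {n} (p : Fin n → Bool) → ∣ tabulate p ∣ ≡ ∑[ k < n ] indicator (p k)
∣tabulate∣≡∑indicator {zero}  p = refl
∣tabulate∣≡∑indicator {suc n} p with p zero
... | true  = cong suc (∣tabulate∣≡∑indicator (p ∘ suc))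
... | false = ∣tabulate∣≡∑indicator (p ∘ suc)

sum-mono-≤ : ∀ {n} {f g : Fin n → ℕ} → (∀ i → f i ≤ g i) → sum f ≤ sum g
sum-mono-≤ {zero}  f≤g = z≤n
sum-mono-≤ {suc n} f≤g = +-mono-≤ (f≤g zero) (sum-mono-≤ (f≤g ∘ suc))

sum-≤-* : ∀ {n} (f : Fin n → ℕ) {c} → (∀ i → f i ≤ c) → sum f ≤ n * c
sum-≤-* {zero}  f f≤c = z≤n
sum-≤-* {suc n} f f≤c = +-mono-≤ (f≤c zero) (sum-≤-* (f ∘ suc) (f≤c ∘ suc))

lookup-≤-sum : ∀ {n} (f : Fin n → ℕ) i → f i ≤ sum f
lookup-≤-sum {suc n} f i = subst (f i ≤_) (sym (sum-remove f)) (m≤m+n (f i) _)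

lookup+lookup-≤-sum : ∀ {n} (f : Fin n → ℕ) {i j} → i ≢ j → f i + f j ≤ sum f
lookup+lookup-≤-sum {suc n} f {i} {j} i≢j = subst (f i + f j ≤_) (sym (sum-remove f)) f[i]+f[j]≤
  where
  f[j]≤ : f j ≤ sum (f ∘ Fin.punchIn i)
  f[j]≤ = subst (_≤ sum (f ∘ Fin.punchIn i)) (cong f (punchIn-punchOut i≢j))
                (lookup-≤-sum (f ∘ Fin.punchIn i) (Fin.punchOut i≢j))
  f[i]+f[j]≤ : f i + f j ≤ f i + sum (f ∘ Fin.punchIn i)
  f[i]+f[j]≤ = +-mono-≤ ≤-refl f[j]≤

∑indicator[≟]≡1 : ∀ {n} (i : Fin n) → ∑[ k < n ] indicator (does (k ≟ i)) ≡ 1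
∑indicator[≟]≡1 {suc n} zero    = cong suc (sum-replicate-zero n)
∑indicator[≟]≡1 {suc n} (suc i) = ∑indicator[≟]≡1 i

m+m≤n*2⇒m≤n : ∀ {m n} → m + m ≤ n * 2 → m ≤ n
m+m≤n*2⇒m≤n {m} {n} m+m≤n*2 =
  ≮⇒≥ λ n<m → <⇒≱ (+-mono-< n<m n<m) (subst (m + m ≤_) n*2≡n+n m+m≤n*2)
  where
  n*2≡n+n : n * 2 ≡ n + n
  n*2≡n+n = trans (*-suc n 1) (cong (n +_) (*-identityʳ n))

next-inject₁ : ∀ {m} (i : Fin m) → next (inject₁ i) ≡ suc i
next-inject₁ {m} i with suc (toℕ (inject₁ i)) <? suc m
... | yes p = toℕ-injective (trans (toℕ-fromℕ< p) (cong suc (toℕ-inject₁ i)))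
... | no ¬p = contradiction (s≤s (subst (_< m) (sym (toℕ-inject₁ i)) (toℕ<n i))) ¬p

next-fromℕ : ∀ m → next (fromℕ m) ≡ zero
next-fromℕ m with suc (toℕ (fromℕ m)) <? suc m
... | yes p = contradiction (subst (λ t → suc t < suc m) (toℕ-fromℕ m) p) (n≮n (suc m))
... | no _  = refl

module _ {X : Set} {m : ℕ} (f : Fin (suc m) → X) (a : Fin (suc m))
         (preserved : ∀ b → b ≢ a → f (next b) ≡ f b) where

  private
    preserved-at-inject₁ : ∀ j → inject₁ j ≢ a → f (suc j) ≡ f (inject₁ j)
    preserved-at-inject₁ j j≢a = trans (cong f (sym (next-inject₁ j))) (preserved (inject₁ j) j≢a)

    constant-up-to : ∀ i → i Fin.≤ a → f i ≡ f zero
    constant-up-to = <-weakInduction (λ i → i Fin.≤ a → f i ≡ f zero) (λ _ → refl) step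
      where
      step : ∀ j → (inject₁ j Fin.≤ a → f (inject₁ j) ≡ f zero) →
             suc j Fin.≤ a → f (suc j) ≡ f zero
      step j ih j<a = trans (preserved-at-inject₁ j (<⇒≢ inject₁j<a)) (ih (<⇒≤ inject₁j<a))
        where inject₁j<a = ℕ<⇒inject₁< {i = a} {j = j} j<a

    constant-after : ∀ i → a Fin.< i → f i ≡ f (next a)
    constant-after = <-weakInduction (λ i → a Fin.< i → f i ≡ f (next a)) (λ ()) step
      where
      step : ∀ j → (a Fin.< inject₁ j → f (inject₁ j) ≡ f (next a)) →
             a Fin.< suc j → f (suc j) ≡ f (next a)
      step j ih (s≤s a≤j) with m≤n⇒m<n∨m≡n a≤j
      ... | inj₁ a<j = trans (preserved-at-inject₁ j (<⇒≢ a<inject₁j ∘ sym)) (ih a<inject₁j)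
        where a<inject₁j = subst (toℕ a <_) (sym (toℕ-inject₁ j)) a<j
      ... | inj₂ a≡j = cong f (trans (sym (next-inject₁ j)) (cong next inject₁j≡a))
        where inject₁j≡a = toℕ-injective (trans (toℕ-inject₁ j) (sym a≡j))

  preserved-but-one⇒preserved : f (next a) ≡ f a
  preserved-but-one⇒preserved with a ≟ fromℕ m
  ... | yes refl = trans (cong f (next-fromℕ m)) (sym (constant-up-to a ≤-refl))
  ... | no a≢last = begin
    f (next a)          ≡⟨ sym (constant-after (fromℕ m) (≤∧≢⇒< (≤fromℕ a) a≢last)) ⟩
    f (fromℕ m)         ≡⟨ sym (preserved (fromℕ m) (a≢last ∘ sym)) ⟩
    f (next (fromℕ m))  ≡⟨ cong f (next-fromℕ m) ⟩
    f zero              ≡⟨ sym (constant-up-to a ≤-refl) ⟩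
    f a                 ∎
    where open ≡-Reasoning

Moves : ∀ {n} → Permutation′ n → Permutation′ n → Fin n → Set
Moves x y k = x ⟨$⟩ˡ (y ⟨$⟩ʳ k) ≢ k

moves? : ∀ {n} (x y : Permutation′ n) (k : Fin n) → Dec (Moves x y k)
moves? x y k = ¬? (x ⟨$⟩ˡ (y ⟨$⟩ʳ k) ≟ k)

module _ {n} (x y : Permutation′ n) (k : Fin n) where

  ¬Moves⇒≡ : ¬ Moves x y k → y ⟨$⟩ʳ k ≡ x ⟨$⟩ʳ k
  ¬Moves⇒≡ fixed = trans (sym (inverseʳ x)) (cong (x ⟨$⟩ʳ_) (decidable-stable (_ ≟ k) fixed))

  ≡⇒¬Moves : y ⟨$⟩ʳ k ≡ x ⟨$⟩ʳ k → ¬ Moves x y k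
  ≡⇒¬Moves yk≡xk moves = moves (trans (cong (x ⟨$⟩ˡ_) yk≡xk) (inverseˡ x))

movedAt : ∀ {n L} (w : Fin L → Permutation′ n) → Fin n → Fin L → ℕ
movedAt w k a = indicator (does (moves? (w a) (w (next a)) k))

movedCount : ∀ {n L} (w : Fin L → Permutation′ n) (k : Fin n) → ℕ
movedCount w k = sum (movedAt w k)

movedByWalk : ∀ {n L} (w : Fin L → Permutation′ n) (k : Fin n) → Bool
movedByWalk w k = does (any? λ a → moves? (w a) (w (next a)) k)

indicator-moves≡1 : ∀ {n} (x y : Permutation′ n) k → Moves x y k → indicator (does (moves? x y k)) ≡ 1
indicator-moves≡1 x y k moves = cong indicator (dec-true (moves? x y k) moves)

moves-once⇒moves-twice : ∀ {n m} (w : Fin (suc m) → Permutation′ n) (k : Fin n) a →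
  Moves (w a) (w (next a)) k → 2 ≤ movedCount w k
moves-once⇒moves-twice w k a a-moves with any? (λ b → ¬? (b ≟ a) ×-dec moves? (w b) (w (next b)) k)
... | yes (b , b≢a , b-moves) =
  subst (_≤ movedCount w k) (cong₂ _+_ (indicator-moves≡1 (w b) (w (next b)) k b-moves)
                                        (indicator-moves≡1 (w a) (w (next a)) k a-moves))
        (lookup+lookup-≤-sum (movedAt w k) b≢a)
... | no no-other-step-moves = contradiction a-moves (≡⇒¬Moves (w a) (w (next a)) k returns)
  where
  returns : w (next a) ⟨$⟩ʳ k ≡ w a ⟨$⟩ʳ k
  returns = preserved-but-one⇒preserved (λ b → w b ⟨$⟩ʳ k) a λ b b≢a →
    ¬Moves⇒≡ (w b) (w (next b)) k λ b-moves → no-other-step-moves (b , b≢a , b-moves)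

movedByWalk-counted-twice : ∀ {n L} (w : Fin L → Permutation′ n) (k : Fin n) →
  indicator (movedByWalk w k) + indicator (movedByWalk w k) ≤ movedCount w k
movedByWalk-counted-twice {L = zero}  w k = z≤n
movedByWalk-counted-twice {L = suc m} w k = by-cases (any? λ a → moves? (w a) (w (next a)) k)
  where
  by-cases : (moved? : Dec (∃ λ a → Moves (w a) (w (next a)) k)) →
             indicator (does moved?) + indicator (does moved?) ≤ movedCount w k
  by-cases (no _)              = z≤n
  by-cases (yes (a , a-moves)) = moves-once⇒moves-twice w k a a-moves

transpose-fixes : ∀ {n} {i j k : Fin n} → k ≢ i → k ≢ j → transpose i j ⟨$⟩ʳ k ≡ k
transpose-fixes {i = i} {j} {k} k≢i k≢j rewrite dec-false (k ≟ i) k≢i | dec-false (k ≟ j) k≢j = refl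

indicator≤1 : ∀ b → indicator b ≤ 1
indicator≤1 true  = ≤-refl
indicator≤1 false = z≤n

adjacent⇒∑indicator[moves]≤2 : ∀ {n} (x y : Permutation′ n) → Adjacent x y →
  ∑[ k < n ] indicator (does (moves? x y k)) ≤ 2
adjacent⇒∑indicator[moves]≤2 {n} x y (i , j , _ , y≡x∘t) = begin
  ∑[ k < n ] indicator (does (moves? x y k))  ≤⟨ sum-mono-≤ moves⇒endpoint ⟩
  ∑[ k < n ] (is i k + is j k)                ≡⟨ ∑-distrib-+ (is i) (is j) ⟩
  ∑[ k < n ] is i k + ∑[ k < n ] is j k       ≡⟨ cong₂ _+_ (∑indicator[≟]≡1 i) (∑indicator[≟]≡1 j) ⟩
  2                                           ∎
  where
  open ≤-Reasoning
  is : Fin n → Fin n → ℕ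
  is i k = indicator (does (k ≟ i))
  moves⇒endpoint : ∀ k → indicator (does (moves? x y k)) ≤ is i k + is j k
  moves⇒endpoint k with k ≟ i | k ≟ j
  ... | yes _   | _       = ≤-trans (indicator≤1 _) (m≤m+n 1 _)
  ... | no _    | yes _   = indicator≤1 _
  ... | no k≢i  | no k≢j  = ≤-reflexive (cong indicator (dec-false (moves? x y k) fixed))
    where
    fixed : ¬ Moves x y k
    fixed = ≡⇒¬Moves x y k (trans (y≡x∘t k) (cong (x ⟨$⟩ʳ_) (transpose-fixes k≢i k≢j)))

∣supp∣≤length : ∀ {n L} (C : Cycle n L) → ∣ supp C ∣ ≤ L
∣supp∣≤length {n} {L} C = m+m≤n*2⇒m≤n (begin
  ∣ supp C ∣ + ∣ supp C ∣                          ≡⟨ cong₂ _+_ ∣supp∣≡ ∣supp∣≡ ⟩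
  ∑[ k < n ] moved k + ∑[ k < n ] moved k          ≡⟨ ∑-distrib-+ moved moved ⟨
  ∑[ k < n ] (moved k + moved k)                   ≤⟨ sum-mono-≤ (movedByWalk-counted-twice w) ⟩
  ∑[ k < n ] movedCount w k                        ≡⟨ ∑-comm (movedAt w) ⟩
  ∑[ a < L ] ∑[ k < n ] movedAt w k a              ≤⟨ sum-≤-* (λ a → ∑[ k < n ] movedAt w k a) edge-moves≤2 ⟩
  L * 2                                            ∎)
  where
  open ≤-Reasoning
  w : Fin L → Permutation′ n
  w = vertex C
  moved : Fin n → ℕ
  moved k = indicator (movedByWalk w k)
  ∣supp∣≡ : ∣ supp C ∣ ≡ ∑[ k < n ] moved k
  ∣supp∣≡ = ∣tabulate∣≡∑indicator (movedByWalk w)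
  edge-moves≤2 : ∀ a → ∑[ k < n ] movedAt w k a ≤ 2
  edge-moves≤2 a = adjacent⇒∑indicator[moves]≤2 (w a) (w (next a)) (adjacent C a)

-- The bound holds for cycles of every length in CT_n.
lemma3p1 : (n l : ℕ) → 3 ≤ n → 2 ≤ l → (C : Cycle n (2 * l)) →
    ∣ supp C ∣ ≤ 2 * l
lemma3p1 n l _ _ C = ∣supp∣≤length C
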